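{- Let $G$ be a graph whose vertex set can be partitioned into a non-trivial clique $K$ and an independent set $I=\{w_1,w_2,w_3\}$ such that each vertex of $K$ is adjacent to each vertex of $I$. Then in any $B_1$-EPG representation of $G$, at least one of the cliques $K_i=K\cup\{w_i\}$, $1\le i\le 3$, is an edge-clique.
   Context: All graphs are finite and simple. An EPG representation of $G$ assigns to each vertex $v$ a path $P_v$ in the rectangular grid such that two distinct vertices are adjacent iff their paths share at least one grid edge; it is a $B_1$-EPG representation if every path has at most one bend. In a $B_1$-EPG representation, a clique is an edge-clique if the paths of all its vertices share a common grid edge. -}

module Defs where

open import Data.Nat using (ℕ; _≤_)
open import Data.Integer as ℤ using (ℤ)
open import Data.Fin using (Fin)
open import Data.Fin.Subset using (Subset; _∈_; ∣_∣)
open import Data.Product using (_×_; ∃; Σ)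
open import Data.Sum using (_⊎_)
open import Function.Bundles using (_⇔_)
open import Relation.Binary.PropositionalEquality using (_≡_; _≢_)
open import Relation.Nullary using (¬_)

-- Edges of the rectangular grid ℤ × ℤ.
--   hor i j : the unit segment from (i , j) to (i + 1 , j)
--   ver i j : the unit segment from (i , j) to (i , j + 1)
data GridEdge : Set where
  hor : ℤ → ℤ → GridEdge
  ver : ℤ → ℤ → GridEdge

-- A grid path with at most one bend: the union of a horizontal segment
-- [a , b] × {y} and a vertical segment {x} × [c , d] which meet at the
-- corner (x , y), the corner being an endpoint of both segments.
-- (If one of the segments is degenerate the path is straight, i.e. has no bend.)
record B1Path : Set where
  constructor mkB1
  field
    x y a b c d : ℤ
    a≤x : a ℤ.≤ x
    x≤b : x ℤ.≤ b
    c≤y : c ℤ.≤ y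
    y≤d : y ℤ.≤ d
    cornerH : (a ≡ x) ⊎ (b ≡ x)
    cornerV : (c ≡ y) ⊎ (d ≡ y)

_∈E_ : GridEdge → B1Path → Set
hor i j ∈E p = (j ≡ B1Path.y p) × (B1Path.a p ℤ.≤ i) × (i ℤ.< B1Path.b p)
ver i j ∈E p = (i ≡ B1Path.x p) × (B1Path.c p ℤ.≤ j) × (j ℤ.< B1Path.d p)

record Graph (n : ℕ) : Set₁ where
  field
    Adj : Fin n → Fin n → Set
    sym : ∀ {u v} → Adj u v → Adj v u
    irrefl : ∀ {u} → ¬ Adj u u

IsB1EPG : ∀ {n} → Graph n → (Fin n → B1Path) → Set
IsB1EPG {n} G P = ∀ (u v : Fin n) → u ≢ v →
  (Graph.Adj G u v ⇔ ∃ λ (e : GridEdge) → (e ∈E P u) × (e ∈E P v))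

IsEdgeClique : ∀ {n} → (Fin n → B1Path) → (Fin n → Set) → Set
IsEdgeClique {n} P C = ∃ λ (e : GridEdge) → ∀ (v : Fin n) → C v → e ∈E P v

IsClique : ∀ {n} → Graph n → Subset n → Set
IsClique G K = ∀ u v → u ∈ K → v ∈ K → u ≢ v → Graph.Adj G u v

-- Three pairwise intersecting paths that are all met by two paths not meeting each other
-- share an edge.  Otherwise they form a claw: two of them bend the same way at a common
-- point, arriving from opposite sides, while the third runs through it; every path meeting
-- all three then contains two of the three edges at that point, so the two outside paths
-- would meet.  Read along the L-shape of one path of K, the paths of K are therefore
-- pairwise meeting intervals, and Helly's theorem on the line makes K an edge-clique, say
-- on row y₀.  Let [A , B] be the longest segment of row y₀ used by all of K.  A path meeting
-- all of K either contains an edge of [A , B] or two of the three edges at one of its ends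
-- that do not lie on it, so two of w₁, w₂, w₃ would share an edge if none of them extended K.
module Submission where

open import Defs
open import Data.Nat using (ℕ; _≤_)
import Data.Nat.Properties as ℕ
open import Data.Integer as ℤ using (ℤ; +_; -[1+_]; _+_; -_; _-_; pred)
open import Data.Integer.Properties
  using (≤-totalOrder; ≤-refl; ≤-antisym; ≤-reflexive; ≤-trans; ≤-<-trans; <-≤-trans; <⇒≤;
         ≤⇒≯; ≤-total; ≰⇒>; neg-mono-≤; neg-mono-<; neg-involutive; i<j⇒suc[i]≤j; suc[i]≤j⇒i<j;
         i<j⇒i≤pred[j]; i≤pred[j]⇒i<j; +-monoʳ-≤; +-monoʳ-<; +-identityʳ; i≤i+j)
open import Data.Integer.Tactic.RingSolver using (solve-∀)
open import Data.Fin as F using (Fin)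
open import Data.Fin.Subset using (Subset; _∈_; _∉_; ∣_∣; Nonempty)
open import Data.List using (List; []; _∷_; filter; allFin)
open import Data.List.Membership.Propositional using () renaming (_∈_ to _∈ₗ_)
open import Data.List.Membership.Propositional.Properties using (∈-filter⁺; ∈-filter⁻; ∈-allFin)
open import Data.List.Relation.Unary.Any using (here; there)
open import Data.Unit using (⊤; tt)
open import Data.Fin.Subset.Properties using (_∈?_; nonempty?; Empty-unique; ∣⊥∣≡0)
import Data.List.Relation.Unary.All as All
open import Data.List.Extrema ≤-totalOrder
  using (argmax; argmin; argmax-all; argmin-all; f[xs]≤f[argmax]; f[argmin]≤f[xs])
open import Function.Bundles using (Equivalence)
open import Data.Product using (_×_; ∃; _,_; proj₁; proj₂)
open import Data.Sum as Sum using (_⊎_; inj₁; inj₂)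
open import Data.Empty using (⊥-elim)
open import Relation.Binary.PropositionalEquality
  using (_≡_; _≢_; refl; sym; trans; cong; cong₂; subst; subst₂)
open import Relation.Nullary using (¬_; yes; no)

open B1Path

pred<self : ∀ i → pred i ℤ.< i
pred<self i = i≤pred[j]⇒i<j ≤-refl

i<suc[i] : ∀ i → i ℤ.< ℤ.suc i
i<suc[i] i = suc[i]≤j⇒i<j ≤-refl

neg-≤-flip : ∀ {i j} → i ℤ.≤ - j → j ℤ.≤ - i
neg-≤-flip {i} {j} i≤-j = subst (ℤ._≤ - i) (neg-involutive j) (neg-mono-≤ i≤-j)

neg-<-flip : ∀ {i j} → - i ℤ.< j → - j ℤ.< i
neg-<-flip {i} {j} -i<j = subst (- j ℤ.<_) (neg-involutive i) (neg-mono-< -i<j)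

i+[j-i]≡j : ∀ i j → i + (j - i) ≡ j
i+[j-i]≡j = solve-∀

j-i≡t⇒i+t≡j : ∀ {i j t} → j - i ≡ t → i + t ≡ j
j-i≡t⇒i+t≡j {i} {j} refl = i+[j-i]≡j i j

i+-[1+m]<i : ∀ i m → i + -[1+ m ] ℤ.< i
i+-[1+m]<i i m = subst (i + -[1+ m ] ℤ.<_) (+-identityʳ i) (+-monoʳ-< i ℤ.-<+)

Share : B1Path → B1Path → Set
Share p q = ∃ λ e → e ∈E p × e ∈E q

Common3 : B1Path → B1Path → B1Path → Set
Common3 p q r = ∃ λ e → e ∈E p × e ∈E q × e ∈E r

Meets3 : B1Path → B1Path → B1Path → B1Path → Set
Meets3 p q r w = Share w p × Share w q × Share w r

CommonEdge : ∀ {n} → Subset n → (Fin n → B1Path) → Set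
CommonEdge K P = ∃ λ e → ∀ v → v ∈ K → e ∈E P v

CommonEdgeWith : ∀ {n} → Subset n → (Fin n → B1Path) → B1Path → Set
CommonEdgeWith K P w = ∃ λ e → e ∈E w × ∀ v → v ∈ K → e ∈E P v

record ApartNeighbours {n} (K : Subset n) (P : Fin n → B1Path) (w₁ w₂ : B1Path) : Set where
  field
    clique : ∀ u v → u ∈ K → v ∈ K → u ≢ v → Share (P u) (P v)
    meets₁ : ∀ v → v ∈ K → Share w₁ (P v)
    meets₂ : ∀ v → v ∈ K → Share w₂ (P v)
    apart : ¬ Share w₁ w₂

record Symmetry : Set where
  field
    path : B1Path → B1Path
    edge edge⁻¹ : GridEdge → GridEdge
    ∈-path : ∀ {e p} → e ∈E p → edge e ∈E path p
    ∈-path⁻¹ : ∀ {e p} → e ∈E path p → edge⁻¹ e ∈E p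

  share : ∀ {p q} → Share p q → Share (path p) (path q)
  share (e , e∈p , e∈q) = edge e , ∈-path e∈p , ∈-path e∈q

  share⁻¹ : ∀ {p q} → Share (path p) (path q) → Share p q
  share⁻¹ (e , e∈p , e∈q) = edge⁻¹ e , ∈-path⁻¹ e∈p , ∈-path⁻¹ e∈q

  meets3 : ∀ {p q r w} → Meets3 p q r w → Meets3 (path p) (path q) (path r) (path w)
  meets3 (wp , wq , wr) = share wp , share wq , share wr

  common-edge⁻¹ : ∀ {n} {K : Subset n} {P} → CommonEdge K (λ v → path (P v)) → CommonEdge K P
  common-edge⁻¹ (e , e∈P) = edge⁻¹ e , λ v v∈K → ∈-path⁻¹ (e∈P v v∈K)

  common-edge-with⁻¹ : ∀ {n} {K : Subset n} {P w} → CommonEdgeWith K (λ v → path (P v)) (path w) →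
    CommonEdgeWith K P w
  common-edge-with⁻¹ (e , e∈w , e∈P) = edge⁻¹ e , ∈-path⁻¹ e∈w , λ v v∈K → ∈-path⁻¹ (e∈P v v∈K)

  apart-neighbours : ∀ {n} {K : Subset n} {P w₁ w₂} → ApartNeighbours K P w₁ w₂ →
    ApartNeighbours K (λ v → path (P v)) (path w₁) (path w₂)
  apart-neighbours N = record
    { clique = λ u v u∈K v∈K u≢v → share (clique u v u∈K v∈K u≢v)
    ; meets₁ = λ v v∈K → share (meets₁ v v∈K)
    ; meets₂ = λ v v∈K → share (meets₂ v v∈K)
    ; apart = λ s → apart (share⁻¹ s)
    }
    where open ApartNeighbours N

  common3⁻¹ : ∀ {p q r} → Common3 (path p) (path q) (path r) → Common3 p q r
  common3⁻¹ (e , e∈p , e∈q , e∈r) = edge⁻¹ e , ∈-path⁻¹ e∈p , ∈-path⁻¹ e∈q , ∈-path⁻¹ e∈r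

_∘ˢ_ : Symmetry → Symmetry → Symmetry
g ∘ˢ h = record
  { path = λ p → G.path (H.path p)
  ; edge = λ e → G.edge (H.edge e)
  ; edge⁻¹ = λ e → H.edge⁻¹ (G.edge⁻¹ e)
  ; ∈-path = λ e∈p → G.∈-path (H.∈-path e∈p)
  ; ∈-path⁻¹ = λ e∈p → H.∈-path⁻¹ (G.∈-path⁻¹ e∈p)
  }
  where
  module G = Symmetry g
  module H = Symmetry h

transpose : Symmetry
transpose = record
  { path = λ p → mkB1 (y p) (x p) (c p) (d p) (a p) (b p)
                      (c≤y p) (y≤d p) (a≤x p) (x≤b p) (cornerV p) (cornerH p)
  ; edge = swap
  ; edge⁻¹ = swap
  ; ∈-path = λ { {hor _ _} e∈p → e∈p ; {ver _ _} e∈p → e∈p }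
  ; ∈-path⁻¹ = λ { {hor _ _} e∈p → e∈p ; {ver _ _} e∈p → e∈p }
  }
  where
  swap : GridEdge → GridEdge
  swap (hor i j) = ver j i
  swap (ver i j) = hor j i

-- A horizontal edge hor i j covers [i, i + 1], whose mirror image is [- (i + 1), - i].
reflectX : Symmetry
reflectX = record
  { path = mirror
  ; edge = mirrorEdge
  ; edge⁻¹ = mirrorEdge
  ; ∈-path = mirror-∈
  ; ∈-path⁻¹ = mirror-∈⁻¹
  }
  where
  mirror : B1Path → B1Path
  mirror p = mkB1 (- x p) (y p) (- b p) (- a p) (c p) (d p)
    (neg-mono-≤ (x≤b p)) (neg-mono-≤ (a≤x p)) (c≤y p) (y≤d p) (flip (cornerH p)) (cornerV p)
    where
    flip : (a p ≡ x p) ⊎ (b p ≡ x p) → (- b p ≡ - x p) ⊎ (- a p ≡ - x p)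
    flip (inj₁ a≡x) = inj₂ (cong -_ a≡x)
    flip (inj₂ b≡x) = inj₁ (cong -_ b≡x)

  mirrorEdge : GridEdge → GridEdge
  mirrorEdge (hor i j) = hor (- ℤ.suc i) j
  mirrorEdge (ver i j) = ver (- i) j

  mirror-∈ : ∀ {e p} → e ∈E p → mirrorEdge e ∈E mirror p
  mirror-∈ {hor i j} (j≡y , a≤i , i<b) =
    j≡y , neg-mono-≤ (i<j⇒suc[i]≤j i<b) , neg-mono-< (≤-<-trans a≤i (i<suc[i] i))
  mirror-∈ {ver i j} (i≡x , c≤j , j<d) = cong -_ i≡x , c≤j , j<d

  mirror-∈⁻¹ : ∀ {e p} → e ∈E mirror p → mirrorEdge e ∈E p
  mirror-∈⁻¹ {hor i j} (j≡y , -b≤i , i<-a) =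
    j≡y , neg-≤-flip (i<j⇒suc[i]≤j i<-a) , neg-<-flip (≤-<-trans -b≤i (i<suc[i] i))
  mirror-∈⁻¹ {ver i j} {p} (i≡-x , c≤j , j<d) =
    trans (cong -_ i≡-x) (neg-involutive (x p)) , c≤j , j<d

reflectY : Symmetry
reflectY = transpose ∘ˢ (reflectX ∘ˢ transpose)

right-arm : ∀ p {i j} → a p ≡ x p → hor i j ∈E p → hor (x p) (y p) ∈E p
right-arm p a≡x (_ , a≤i , i<b) = refl , ≤-reflexive a≡x , subst (ℤ._< b p) a≡x (≤-<-trans a≤i i<b)

left-arm : ∀ p {i j} → b p ≡ x p → hor i j ∈E p → hor (pred (x p)) (y p) ∈E p
left-arm p b≡x (_ , a≤i , i<b) =
  refl , i<j⇒i≤pred[j] (<-≤-trans (≤-<-trans a≤i i<b) (≤-reflexive b≡x))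
  , <-≤-trans (pred<self (x p)) (≤-reflexive (sym b≡x))

up-arm : ∀ p {i j} → c p ≡ y p → ver i j ∈E p → ver (x p) (y p) ∈E p
up-arm p c≡y (_ , c≤j , j<d) = refl , ≤-reflexive c≡y , subst (ℤ._< d p) c≡y (≤-<-trans c≤j j<d)

down-arm : ∀ p {i j} → d p ≡ y p → ver i j ∈E p → ver (x p) (pred (y p)) ∈E p
down-arm p d≡y (_ , c≤j , j<d) =
  refl , i<j⇒i≤pred[j] (<-≤-trans (≤-<-trans c≤j j<d) (≤-reflexive d≡y))
  , <-≤-trans (pred<self (y p)) (≤-reflexive (sym d≡y))

corner-hor : ∀ w {i j px py} → x w ≡ px → y w ≡ py → hor i j ∈E w →
  hor px py ∈E w ⊎ hor (pred px) py ∈E w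
corner-hor w refl refl h with cornerH w
... | inj₁ a≡x = inj₁ (right-arm w a≡x h)
... | inj₂ b≡x = inj₂ (left-arm w b≡x h)

corner-ver : ∀ w {i j px py} → x w ≡ px → y w ≡ py → ver i j ∈E w →
  ver px py ∈E w ⊎ ver px (pred py) ∈E w
corner-ver w refl refl v with cornerV w
... | inj₁ c≡y = inj₁ (up-arm w c≡y v)
... | inj₂ d≡y = inj₂ (down-arm w d≡y v)

Convex : (ℤ → Set) → Set
Convex S = ∀ {s t u} → s ℤ.≤ t → t ℤ.≤ u → S s → S u → S t

Meet : (ℤ → Set) → (ℤ → Set) → Set
Meet S T = ∃ λ t → S t × T t

-- The median of the three witnesses lies in all three sets.
helly₃ : ∀ {S T U : ℤ → Set} → Convex S → Convex T → Convex U →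
  Meet S T → Meet T U → Meet S U → ∃ λ t → S t × T t × U t
helly₃ cS cT cU (p , Sp , Tp) (q , Tq , Uq) (r , Sr , Ur)
  with ≤-total p q | ≤-total q r | ≤-total p r
... | inj₁ p≤q | inj₁ q≤r | _        = q , cS p≤q q≤r Sp Sr , Tq , Uq
... | inj₁ p≤q | inj₂ r≤q | inj₁ p≤r = r , Sr , cT p≤r r≤q Tp Tq , Ur
... | inj₁ p≤q | inj₂ r≤q | inj₂ r≤p = p , Sp , Tp , cU r≤p p≤q Ur Uq
... | inj₂ q≤p | _        | inj₁ p≤r = p , Sp , Tp , cU q≤p p≤r Uq Ur
... | inj₂ q≤p | inj₁ q≤r | inj₂ r≤p = r , Sr , cT q≤r r≤p Tq Tp , Ur
... | inj₂ q≤p | inj₂ r≤q | inj₂ r≤p = q , cS r≤q q≤p Sr Sp , Tq , Uq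

module _ {I : Set} (F : I → ℤ → Set) where

  private
    helly-within : (S : ℤ → Set) → Convex S → ∃ S → (L : List I) →
      (∀ {i} → i ∈ₗ L → Convex (F i)) → (∀ {i} → i ∈ₗ L → Meet S (F i)) →
      (∀ {i j} → i ∈ₗ L → j ∈ₗ L → Meet (F i) (F j)) → ∃ λ t → S t × (∀ {i} → i ∈ₗ L → F i t)
    helly-within S _ (t , St) [] _ _ _ = t , St , λ ()
    helly-within S cS _ (i ∷ L) convex meetS meet
      with helly-within (λ t → S t × F i t) cSᵢ (meetS (here refl)) L (λ j∈L → convex (there j∈L))
             meetSᵢ (λ j∈L k∈L → meet (there j∈L) (there k∈L))
      where
      cSᵢ : Convex (λ t → S t × F i t)
      cSᵢ s≤t t≤u (Ss , Fᵢs) (Su , Fᵢu) = cS s≤t t≤u Ss Su , convex (here refl) s≤t t≤u Fᵢs Fᵢu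
      meetSᵢ : ∀ {j} → j ∈ₗ L → Meet (λ t → S t × F i t) (F j)
      meetSᵢ j∈L with helly₃ cS (convex (here refl)) (convex (there j∈L))
                            (meetS (here refl)) (meet (here refl) (there j∈L)) (meetS (there j∈L))
      ... | t , St , Fᵢt , Fⱼt = t , (St , Fᵢt) , Fⱼt
    ... | t , (St , Fᵢt) , FLt = t , St , λ { (here refl) → Fᵢt ; (there j∈L) → FLt j∈L }

  helly : (L : List I) → (∀ {i} → i ∈ₗ L → Convex (F i)) →
    (∀ {i j} → i ∈ₗ L → j ∈ₗ L → Meet (F i) (F j)) → ∃ λ t → ∀ {i} → i ∈ₗ L → F i t
  helly L convex meet with helly-within (λ _ → ⊤) (λ _ _ _ _ → tt) (+ 0 , tt) L convex
                             (λ i∈L → proj₁ (meet i∈L i∈L) , tt , proj₁ (proj₂ (meet i∈L i∈L))) meet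
  ... | t , _ , Ft = t , Ft

members : ∀ {n} → Subset n → List (Fin n)
members K = filter (_∈? K) (allFin _)

∈-members⁺ : ∀ {n} {K : Subset n} {v} → v ∈ K → v ∈ₗ members K
∈-members⁺ {K = K} {v} v∈K = ∈-filter⁺ (_∈? K) (∈-allFin v) v∈K

∈-members⁻ : ∀ {n} {K : Subset n} {v} → v ∈ₗ members K → v ∈ K
∈-members⁻ {K = K} v∈ = proj₂ (∈-filter⁻ (_∈? K) {xs = allFin _} v∈)

argmax-subset : ∀ {n} (K : Subset n) (f : Fin n → ℤ) {k₀} → k₀ ∈ K →
  ∃ λ m → m ∈ K × (∀ k → k ∈ K → f k ℤ.≤ f m)
argmax-subset K f {k₀} k₀∈K =
  argmax f k₀ (members K) , argmax-all f k₀∈K (All.tabulate ∈-members⁻) ,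
  λ k k∈K → All.lookup (f[xs]≤f[argmax] k₀ (members K)) (∈-members⁺ k∈K)

argmin-subset : ∀ {n} (K : Subset n) (f : Fin n → ℤ) {k₀} → k₀ ∈ K →
  ∃ λ m → m ∈ K × (∀ k → k ∈ K → f m ℤ.≤ f k)
argmin-subset K f {k₀} k₀∈K =
  argmin f k₀ (members K) , argmin-all f k₀∈K (All.tabulate ∈-members⁻) ,
  λ k k∈K → All.lookup (f[argmin]≤f[xs] k₀ (members K)) (∈-members⁺ k∈K)

helly-subset : ∀ {n} (K : Subset n) (F : Fin n → ℤ → Set) → (∀ v → v ∈ K → Convex (F v)) →
  (∀ u v → u ∈ K → v ∈ K → Meet (F u) (F v)) → ∃ λ t → ∀ v → v ∈ K → F v t
helly-subset K F convex meet
  with helly F (members K) (λ v∈ → convex _ (∈-members⁻ v∈))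
              (λ u∈ v∈ → meet _ _ (∈-members⁻ u∈) (∈-members⁻ v∈))
... | t , Ft = t , λ v v∈K → Ft (∈-members⁺ v∈K)

hor-convex : ∀ {j p} → Convex (λ i → hor i j ∈E p)
hor-convex i≤t t≤u (j≡y , a≤i , _) (_ , _ , u<b) = j≡y , ≤-trans a≤i i≤t , ≤-<-trans t≤u u<b

ver-convex : ∀ {i p} → Convex (λ j → ver i j ∈E p)
ver-convex j≤t t≤u (i≡x , c≤j , _) (_ , _ , u<d) = i≡x , ≤-trans c≤j j≤t , ≤-<-trans t≤u u<d

move-row : ∀ p {i j j'} → j' ≡ y p → hor i j ∈E p → hor i j' ∈E p
move-row _ j'≡y (_ , a≤i , i<b) = j'≡y , a≤i , i<b

row-helly : ∀ {p q r i₁ j₁ i₂ j₂ i₃ j₃} →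
  hor i₁ j₁ ∈E p → hor i₁ j₁ ∈E q → hor i₂ j₂ ∈E p → hor i₂ j₂ ∈E r →
  hor i₃ j₃ ∈E q → hor i₃ j₃ ∈E r → Common3 p q r
row-helly {p} {q} {r} {i₁} {_} {i₂} {_} {i₃} p₁ q₁ p₂ r₂ q₃ r₃
  with helly₃ (hor-convex {y p} {p}) (hor-convex {y p} {q}) (hor-convex {y p} {r})
         (i₁ , move-row p refl p₁ , move-row q yq q₁) (i₃ , move-row q yq q₃ , move-row r yr r₃)
         (i₂ , move-row p refl p₂ , move-row r yr r₂)
  where
  yq : y p ≡ y q
  yq = trans (sym (proj₁ p₁)) (proj₁ q₁)
  yr : y p ≡ y r
  yr = trans (sym (proj₁ p₂)) (proj₁ r₂)
... | i , pᵢ , qᵢ , rᵢ = hor i (y p) , pᵢ , qᵢ , rᵢ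

data TwoOf (e₁ e₂ e₃ : GridEdge) (w : B1Path) : Set where
  has₁₂ : e₁ ∈E w → e₂ ∈E w → TwoOf e₁ e₂ e₃ w
  has₁₃ : e₁ ∈E w → e₃ ∈E w → TwoOf e₁ e₂ e₃ w
  has₂₃ : e₂ ∈E w → e₃ ∈E w → TwoOf e₁ e₂ e₃ w

two-of-either : ∀ {e₁ e₂ e₃ w} → e₁ ∈E w → e₂ ∈E w ⊎ e₃ ∈E w → TwoOf e₁ e₂ e₃ w
two-of-either e₁∈w (inj₁ e₂∈w) = has₁₂ e₁∈w e₂∈w
two-of-either e₁∈w (inj₂ e₃∈w) = has₁₃ e₁∈w e₃∈w

two-of-share : ∀ {e₁ e₂ e₃ w w'} → TwoOf e₁ e₂ e₃ w → TwoOf e₁ e₂ e₃ w' → Share w w'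
two-of-share (has₁₂ e₁∈w _)    (has₁₂ e₁∈w' _)    = _ , e₁∈w , e₁∈w'
two-of-share (has₁₂ e₁∈w _)    (has₁₃ e₁∈w' _)    = _ , e₁∈w , e₁∈w'
two-of-share (has₁₂ _ e₂∈w)    (has₂₃ e₂∈w' _)    = _ , e₂∈w , e₂∈w'
two-of-share (has₁₃ e₁∈w _)    (has₁₂ e₁∈w' _)    = _ , e₁∈w , e₁∈w'
two-of-share (has₁₃ e₁∈w _)    (has₁₃ e₁∈w' _)    = _ , e₁∈w , e₁∈w'
two-of-share (has₁₃ _ e₃∈w)    (has₂₃ _ e₃∈w')    = _ , e₃∈w , e₃∈w'
two-of-share (has₂₃ e₂∈w _)    (has₁₂ _ e₂∈w')    = _ , e₂∈w , e₂∈w'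
two-of-share (has₂₃ _ e₃∈w)    (has₁₃ _ e₃∈w')    = _ , e₃∈w , e₃∈w'
two-of-share (has₂₃ e₂∈w _)    (has₂₃ e₂∈w' _)    = _ , e₂∈w , e₂∈w'

-- The claw: Y and Z both bend upwards at the point o = (x Y , y Y), Y arriving from the
-- left and Z leaving to the right, while X runs along the row of o without bending in its
-- column.
module Claw (X Y Z : B1Path)
  (b≡xY : b Y ≡ x Y) (c≡yY : c Y ≡ y Y) (a≡xZ : a Z ≡ x Z) (c≡yZ : c Z ≡ y Z)
  (xZ≡xY : x Z ≡ x Y) (yZ≡yY : y Z ≡ y Y) (yX≡yY : y X ≡ y Y) (xX≢xY : x X ≢ x Y) where

  ox oy : ℤ
  ox = x Y
  oy = y Y

  ClawEdges : B1Path → Set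
  ClawEdges = TwoOf (hor (pred ox) oy) (hor ox oy) (ver ox oy)

  private
    row-through-o : ∀ w {i j i' j'} → hor i j ∈E w → hor i j ∈E Y → hor i' j' ∈E w → hor i' j' ∈E Z →
      ClawEdges w
    row-through-o w {i} (j≡yw , a≤i , _) (j≡yY , _ , i<bY) (_ , _ , i'<bw) (_ , aZ≤i' , _) =
      has₁₂ (yY≡yw , ≤-trans a≤i (i<j⇒i≤pred[j] i<ox) , <-≤-trans (pred<self ox) (<⇒≤ ox<bw))
         (yY≡yw , ≤-trans a≤i (<⇒≤ i<ox) , ox<bw)
      where
      yY≡yw : y Y ≡ y w
      yY≡yw = trans (sym j≡yY) j≡yw
      i<ox : i ℤ.< ox
      i<ox = <-≤-trans i<bY (≤-reflexive b≡xY)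
      ox<bw : ox ℤ.< b w
      ox<bw = ≤-<-trans (≤-trans (≤-reflexive (sym (trans a≡xZ xZ≡xY))) aZ≤i') i'<bw

    column-through-o : ∀ {w i j} → Share w X → ver i j ∈E w → oy ℤ.≤ j → x w ≡ ox → ClawEdges w
    column-through-o (ver _ _ , (i'≡xw , _) , (i'≡xX , _)) _ _ xw≡ox =
      ⊥-elim (xX≢xY (trans (sym i'≡xX) (trans i'≡xw xw≡ox)))
    column-through-o {w} (hor i' j' , h∈w , (j'≡yX , _)) (_ , _ , j<d) oy≤j xw≡ox =
      add-corner (corner-hor w xw≡ox yw≡oy h∈w)
      where
      yw≡oy : y w ≡ oy
      yw≡oy = trans (sym (proj₁ h∈w)) (trans j'≡yX yX≡yY)
      c≡y : c w ≡ y w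
      c≡y with cornerV w
      ... | inj₁ c≡y = c≡y
      ... | inj₂ d≡y = ⊥-elim (≤⇒≯ oy≤j (<-≤-trans j<d (≤-reflexive (trans d≡y yw≡oy))))
      up : ver ox oy ∈E w
      up = sym xw≡ox , ≤-reflexive (trans c≡y yw≡oy) , ≤-<-trans oy≤j j<d
      add-corner : hor ox oy ∈E w ⊎ hor (pred ox) oy ∈E w → ClawEdges w
      add-corner (inj₁ right) = has₂₃ right up
      add-corner (inj₂ left) = has₁₃ left up

  claw-edges : ∀ {w} → Meets3 X Y Z w → ClawEdges w
  claw-edges {w} (wX , (hor i j , hw , hY) , (hor i' j' , h'w , h'Z)) = row-through-o w hw hY h'w h'Z
  claw-edges (wX , (ver i j , vw , (i≡xY , c≤j , _)) , _) =
    column-through-o wX vw (subst (ℤ._≤ j) c≡yY c≤j) (trans (sym (proj₁ vw)) i≡xY)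
  claw-edges (wX , (hor _ _ , _) , (ver i j , vw , (i≡xZ , c≤j , _))) =
    column-through-o wX vw (subst (ℤ._≤ j) (trans c≡yZ yZ≡yY) c≤j)
                           (trans (sym (proj₁ vw)) (trans i≡xZ xZ≡xY))

opposite-arms : ∀ X Y Z {w₁ w₂ i₁ j₁ i₂ j₂ i₃ j₃} → Meets3 X Y Z w₁ → Meets3 X Y Z w₂ →
  hor i₁ j₁ ∈E X → hor i₁ j₁ ∈E Y → hor i₂ j₂ ∈E X → hor i₂ j₂ ∈E Z →
  ver i₃ j₃ ∈E Y → ver i₃ j₃ ∈E Z → b Y ≡ x Y → a Z ≡ x Z → Share w₁ w₂
opposite-arms X Y Z {w₁} {w₂} {j₃ = j₃} m₁ m₂ h₁X h₁Y h₂X h₂Z v₃Y v₃Z b≡xY a≡xZ =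
  by-vertical-arms (cornerV Y) (cornerV Z)
  where
  xZ≡xY : x Z ≡ x Y
  xZ≡xY = trans (sym (proj₁ v₃Z)) (proj₁ v₃Y)
  yX≡yY : y X ≡ y Y
  yX≡yY = trans (sym (proj₁ h₁X)) (proj₁ h₁Y)
  yZ≡yY : y Z ≡ y Y
  yZ≡yY = trans (sym (proj₁ h₂Z)) (trans (proj₁ h₂X) yX≡yY)

  -- X meets Y left of Y's column and Z right of it, so it cannot bend in that column.
  xX≢xY : x X ≢ x Y
  xX≢xY xX≡xY with cornerH X
  ... | inj₁ a≡x = ≤⇒≯ (≤-trans (≤-reflexive (sym (trans a≡x xX≡xY))) (proj₁ (proj₂ h₁X)))
                        (<-≤-trans (proj₂ (proj₂ h₁Y)) (≤-reflexive b≡xY))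
  ... | inj₂ b≡x = ≤⇒≯ (≤-trans (≤-reflexive (sym (trans a≡xZ xZ≡xY))) (proj₁ (proj₂ h₂Z)))
                        (<-≤-trans (proj₂ (proj₂ h₂X)) (≤-reflexive (trans b≡x xX≡xY)))

  by-vertical-arms : (c Y ≡ y Y) ⊎ (d Y ≡ y Y) → (c Z ≡ y Z) ⊎ (d Z ≡ y Z) → Share w₁ w₂
  by-vertical-arms (inj₁ c≡yY) (inj₁ c≡yZ) =
    two-of-share (claw-edges m₁) (claw-edges m₂)
    where open Claw X Y Z b≡xY c≡yY a≡xZ c≡yZ xZ≡xY yZ≡yY yX≡yY xX≢xY
  by-vertical-arms (inj₂ d≡yY) (inj₂ d≡yZ) =
    share⁻¹ (two-of-share (claw-edges (meets3 m₁)) (claw-edges (meets3 m₂)))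
    where
    open Symmetry reflectY
    open Claw (path X) (path Y) (path Z) b≡xY (cong -_ d≡yY) a≡xZ (cong -_ d≡yZ)
              xZ≡xY (cong -_ yZ≡yY) (cong -_ yX≡yY) xX≢xY
  by-vertical-arms (inj₁ c≡yY) (inj₂ d≡yZ) =
    ⊥-elim (≤⇒≯ (subst (ℤ._≤ j₃) c≡yY (proj₁ (proj₂ v₃Y)))
                 (subst (j₃ ℤ.<_) (trans d≡yZ yZ≡yY) (proj₂ (proj₂ v₃Z))))
  by-vertical-arms (inj₂ d≡yY) (inj₁ c≡yZ) =
    ⊥-elim (≤⇒≯ (subst (ℤ._≤ j₃) (trans c≡yZ yZ≡yY) (proj₁ (proj₂ v₃Z)))
                 (subst (j₃ ℤ.<_) d≡yY (proj₂ (proj₂ v₃Y))))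

triangle-hhv : ∀ X Y Z {w₁ w₂ i₁ j₁ i₂ j₂ i₃ j₃} → ¬ Share w₁ w₂ → Meets3 X Y Z w₁ → Meets3 X Y Z w₂ →
  hor i₁ j₁ ∈E X → hor i₁ j₁ ∈E Y → hor i₂ j₂ ∈E X → hor i₂ j₂ ∈E Z →
  ver i₃ j₃ ∈E Y → ver i₃ j₃ ∈E Z → Common3 X Y Z
triangle-hhv X Y Z nw m₁ m₂ h₁X h₁Y h₂X h₂Z v₃Y v₃Z = by-horizontal-arms (cornerH Y) (cornerH Z)
  where
  xZ≡xY : x Z ≡ x Y
  xZ≡xY = trans (sym (proj₁ v₃Z)) (proj₁ v₃Y)
  yZ≡yY : y Z ≡ y Y
  yZ≡yY = trans (sym (proj₁ h₂Z)) (trans (proj₁ h₂X) (trans (sym (proj₁ h₁X)) (proj₁ h₁Y)))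

  in-Y-frame : ∀ {f : ℤ → ℤ} → hor (f (x Z)) (y Z) ∈E Z → hor (f (x Y)) (y Y) ∈E Z
  in-Y-frame {f} = subst₂ (λ i j → hor (f i) j ∈E Z) xZ≡xY yZ≡yY

  by-horizontal-arms : (a Y ≡ x Y) ⊎ (b Y ≡ x Y) → (a Z ≡ x Z) ⊎ (b Z ≡ x Z) → Common3 X Y Z
  by-horizontal-arms (inj₁ a≡xY) (inj₁ a≡xZ) =
    row-helly h₁X h₁Y h₂X h₂Z (right-arm Y a≡xY h₁Y) (in-Y-frame {λ i → i} (right-arm Z a≡xZ h₂Z))
  by-horizontal-arms (inj₂ b≡xY) (inj₂ b≡xZ) =
    row-helly h₁X h₁Y h₂X h₂Z (left-arm Y b≡xY h₁Y) (in-Y-frame {pred} (left-arm Z b≡xZ h₂Z))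
  by-horizontal-arms (inj₂ b≡xY) (inj₁ a≡xZ) =
    ⊥-elim (nw (opposite-arms X Y Z m₁ m₂ h₁X h₁Y h₂X h₂Z v₃Y v₃Z b≡xY a≡xZ))
  by-horizontal-arms (inj₁ a≡xY) (inj₂ b≡xZ) =
    ⊥-elim (nw (opposite-arms X Z Y (swap m₁) (swap m₂) h₂X h₂Z h₁X h₁Y v₃Z v₃Y b≡xZ a≡xY))
    where
    swap : ∀ {w} → Meets3 X Y Z w → Meets3 X Z Y w
    swap (wX , wY , wZ) = wX , wZ , wY

data MostlyHorizontal : GridEdge → GridEdge → GridEdge → Set where
  hhh : ∀ {i₁ j₁ i₂ j₂ i₃ j₃} → MostlyHorizontal (hor i₁ j₁) (hor i₂ j₂) (hor i₃ j₃)
  hhv : ∀ {i₁ j₁ i₂ j₂ i₃ j₃} → MostlyHorizontal (hor i₁ j₁) (hor i₂ j₂) (ver i₃ j₃)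
  hvh : ∀ {i₁ j₁ i₂ j₂ i₃ j₃} → MostlyHorizontal (hor i₁ j₁) (ver i₂ j₂) (hor i₃ j₃)
  vhh : ∀ {i₁ j₁ i₂ j₂ i₃ j₃} → MostlyHorizontal (ver i₁ j₁) (hor i₂ j₂) (hor i₃ j₃)

mostly-horizontal-or-transposed : ∀ e₁ e₂ e₃ → let open Symmetry transpose in
  MostlyHorizontal e₁ e₂ e₃ ⊎ MostlyHorizontal (edge e₁) (edge e₂) (edge e₃)
mostly-horizontal-or-transposed (hor _ _) (hor _ _) (hor _ _) = inj₁ hhh
mostly-horizontal-or-transposed (hor _ _) (hor _ _) (ver _ _) = inj₁ hhv
mostly-horizontal-or-transposed (hor _ _) (ver _ _) (hor _ _) = inj₁ hvh
mostly-horizontal-or-transposed (ver _ _) (hor _ _) (hor _ _) = inj₁ vhh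
mostly-horizontal-or-transposed (hor _ _) (ver _ _) (ver _ _) = inj₂ vhh
mostly-horizontal-or-transposed (ver _ _) (hor _ _) (ver _ _) = inj₂ hvh
mostly-horizontal-or-transposed (ver _ _) (ver _ _) (hor _ _) = inj₂ hhv
mostly-horizontal-or-transposed (ver _ _) (ver _ _) (ver _ _) = inj₂ hhh

triangle-mostly-horizontal : ∀ p q r {w₁ w₂ e₁ e₂ e₃} → ¬ Share w₁ w₂ →
  Meets3 p q r w₁ → Meets3 p q r w₂ →
  e₁ ∈E p → e₁ ∈E q → e₂ ∈E p → e₂ ∈E r → e₃ ∈E q → e₃ ∈E r →
  MostlyHorizontal e₁ e₂ e₃ → Common3 p q r
triangle-mostly-horizontal p q r nw m₁ m₂ e₁p e₁q e₂p e₂r e₃q e₃r hhh = row-helly e₁p e₁q e₂p e₂r e₃q e₃r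
triangle-mostly-horizontal p q r nw m₁ m₂ e₁p e₁q e₂p e₂r e₃q e₃r hhv =
  triangle-hhv p q r nw m₁ m₂ e₁p e₁q e₂p e₂r e₃q e₃r
triangle-mostly-horizontal p q r nw m₁ m₂ e₁p e₁q e₂p e₂r e₃q e₃r hvh
  with triangle-hhv q p r nw (hub-q m₁) (hub-q m₂) e₁q e₁p e₃q e₃r e₂p e₂r
  where
  hub-q : ∀ {w} → Meets3 p q r w → Meets3 q p r w
  hub-q (wp , wq , wr) = wq , wp , wr
... | e , e∈q , e∈p , e∈r = e , e∈p , e∈q , e∈r
triangle-mostly-horizontal p q r nw m₁ m₂ e₁p e₁q e₂p e₂r e₃q e₃r vhh
  with triangle-hhv r p q nw (hub-r m₁) (hub-r m₂) e₂r e₂p e₃r e₃q e₁p e₁q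
  where
  hub-r : ∀ {w} → Meets3 p q r w → Meets3 r p q w
  hub-r (wp , wq , wr) = wr , wp , wq
... | e , e∈r , e∈p , e∈q = e , e∈p , e∈q , e∈r

triangle-common-edge : ∀ {p q r w₁ w₂} → ¬ Share w₁ w₂ → Meets3 p q r w₁ → Meets3 p q r w₂ →
  Share p q → Share p r → Share q r → Common3 p q r
triangle-common-edge {p} {q} {r} nw m₁ m₂ (e₁ , e₁p , e₁q) (e₂ , e₂p , e₂r) (e₃ , e₃q , e₃r)
  with mostly-horizontal-or-transposed e₁ e₂ e₃
... | inj₁ mh = triangle-mostly-horizontal p q r nw m₁ m₂ e₁p e₁q e₂p e₂r e₃q e₃r mh
... | inj₂ mh = common3⁻¹ (triangle-mostly-horizontal (path p) (path q) (path r) (λ s → nw (share⁻¹ s))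
                  (meets3 m₁) (meets3 m₂) (∈-path e₁p) (∈-path e₁q) (∈-path e₂p) (∈-path e₂r)
                  (∈-path e₃q) (∈-path e₃r) mh)
  where open Symmetry transpose

-- The edges of the infinite L-shape bending at (x₀ , y₀), arriving from the left and leaving
-- upwards, enumerated by ℤ: negative parameters are the row edges, the others the column edges.
module LShape (x₀ y₀ : ℤ) where

  edgeAt : ℤ → GridEdge
  edgeAt (+ m) = ver x₀ (y₀ + + m)
  edgeAt t@(-[1+ _ ]) = hor (x₀ + t) y₀

  -- A path bends only once, so it cannot leave and re-enter the L-shape.
  edgeAt-convex : ∀ q → Convex (λ t → edgeAt t ∈E q)
  edgeAt-convex q {+ _} {+ _} {+ _} s≤t t≤u hs hu =
    ver-convex {x₀} {q} (+-monoʳ-≤ y₀ s≤t) (+-monoʳ-≤ y₀ t≤u) hs hu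
  edgeAt-convex q { -[1+ _ ]} { -[1+ _ ]} { -[1+ _ ]} s≤t t≤u hs hu =
    hor-convex {y₀} {q} (+-monoʳ-≤ x₀ s≤t) (+-monoʳ-≤ x₀ t≤u) hs hu
  edgeAt-convex q {s@(-[1+ m ])} {t@(-[1+ n ])} {+ _} s≤t _ (y₀≡y , a≤x₀+s , _) (x₀≡x , _) =
    y₀≡y , ≤-trans a≤x₀+s (+-monoʳ-≤ x₀ s≤t) , x₀+t<b (cornerH q)
    where
    x₀+t<b : (a q ≡ x q) ⊎ (b q ≡ x q) → x₀ + t ℤ.< b q
    x₀+t<b (inj₁ a≡x) = ⊥-elim (≤⇒≯ (≤-trans (≤-reflexive (trans x₀≡x (sym a≡x))) a≤x₀+s) (i+-[1+m]<i x₀ m))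
    x₀+t<b (inj₂ b≡x) = <-≤-trans (i+-[1+m]<i x₀ n) (≤-reflexive (trans x₀≡x (sym b≡x)))
  edgeAt-convex q { -[1+ _ ]} {+ t} {+ u} _ t≤u (y₀≡y , _) (x₀≡x , _ , y₀+u<d) =
    x₀≡x , c≤y₀+t (cornerV q) , ≤-<-trans (+-monoʳ-≤ y₀ t≤u) y₀+u<d
    where
    c≤y₀+t : (c q ≡ y q) ⊎ (d q ≡ y q) → c q ℤ.≤ y₀ + + t
    c≤y₀+t (inj₁ c≡y) = ≤-trans (≤-reflexive (trans c≡y (sym y₀≡y))) (i≤i+j y₀ (+ t))
    c≤y₀+t (inj₂ d≡y) =
      ⊥-elim (≤⇒≯ (i≤i+j y₀ (+ u)) (<-≤-trans y₀+u<d (≤-reflexive (trans d≡y (sym y₀≡y)))))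
  edgeAt-convex _ {+ _} { -[1+ _ ]} ()
  edgeAt-convex _ {_} {+ _} { -[1+ _ ]} _ ()

  edgeAt-onto : ∀ p → x p ≡ x₀ → y p ≡ y₀ → b p ≡ x₀ → c p ≡ y₀ → ∀ e → e ∈E p → ∃ λ t → edgeAt t ≡ e
  edgeAt-onto p _ y≡y₀ b≡x₀ _ (hor i j) (j≡y , _ , i<b) with i - x₀ in eq
  ... | + m = ⊥-elim (≤⇒≯ (subst (x₀ ℤ.≤_) (j-i≡t⇒i+t≡j eq) (i≤i+j x₀ (+ m)))
                          (<-≤-trans i<b (≤-reflexive b≡x₀)))
  ... | -[1+ m ] = -[1+ m ] , cong₂ hor (j-i≡t⇒i+t≡j eq) (sym (trans j≡y y≡y₀))
  edgeAt-onto p x≡x₀ _ _ c≡y₀ (ver i j) (i≡x , c≤j , _) with j - y₀ in eq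
  ... | + m = + m , cong₂ ver (sym (trans i≡x x≡x₀)) (j-i≡t⇒i+t≡j eq)
  ... | -[1+ m ] = ⊥-elim (≤⇒≯ (subst (ℤ._≤ j) c≡y₀ c≤j)
                               (subst (ℤ._< y₀) (j-i≡t⇒i+t≡j eq) (i+-[1+m]<i y₀ m)))

module _ {n} {K : Subset n} {P : Fin n → B1Path} {w₁ w₂} (N : ApartNeighbours K P w₁ w₂) where
  open ApartNeighbours N

  private
    share-within : ∀ u v → u ∈ K → v ∈ K → Share (P u) (P v)
    share-within u v u∈K v∈K with u F.≟ v
    ... | yes refl = let (e , _ , e∈P) = meets₁ u u∈K in e , e∈P , e∈P
    ... | no u≢v = clique u v u∈K v∈K u≢v

    common3-within : ∀ {k u v} → k ∈ K → u ∈ K → v ∈ K → Common3 (P k) (P u) (P v)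
    common3-within {k} {u} {v} k∈K u∈K v∈K =
      triangle-common-edge apart (meets₁ k k∈K , meets₁ u u∈K , meets₁ v v∈K)
        (meets₂ k k∈K , meets₂ u u∈K , meets₂ v v∈K)
        (share-within k u k∈K u∈K) (share-within k v k∈K v∈K) (share-within u v u∈K v∈K)

  -- The triangle lemma makes the traces of the paths of K on the L-shape of P k₀
  -- pairwise intersecting intervals.
  edge-clique-bending-up-from-left : ∀ {k₀} → k₀ ∈ K → b (P k₀) ≡ x (P k₀) → c (P k₀) ≡ y (P k₀) →
    CommonEdge K P
  edge-clique-bending-up-from-left {k₀} k₀∈K b≡x c≡y
    with helly-subset K (λ v t → edgeAt t ∈E P v) (λ v _ → edgeAt-convex (P v)) meet
    where
    open LShape (x (P k₀)) (y (P k₀))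
    meet : ∀ u v → u ∈ K → v ∈ K → Meet (λ t → edgeAt t ∈E P u) (λ t → edgeAt t ∈E P v)
    meet u v u∈K v∈K with common3-within k₀∈K u∈K v∈K
    ... | e , e∈P₀ , e∈Pu , e∈Pv with edgeAt-onto (P k₀) refl refl b≡x c≡y e e∈P₀
    ... | t , refl = t , e∈Pu , e∈Pv
  ... | t , t∈P = LShape.edgeAt (x (P k₀)) (y (P k₀)) t , t∈P

edge-clique-via : ∀ (g : Symmetry) {n} {K : Subset n} {P w₁ w₂} →
  ApartNeighbours K P w₁ w₂ → ∀ {k₀} → k₀ ∈ K →
  let q = Symmetry.path g (P k₀) in b q ≡ x q → c q ≡ y q → CommonEdge K P
edge-clique-via g N k₀∈K b≡x c≡y =
  common-edge⁻¹ (edge-clique-bending-up-from-left (apart-neighbours N) k₀∈K b≡x c≡y)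
  where open Symmetry g

edge-clique : ∀ {n} {K : Subset n} {P w₁ w₂} → ApartNeighbours K P w₁ w₂ → ∀ {k₀} → k₀ ∈ K →
  CommonEdge K P
edge-clique {P = P} N {k₀} k₀∈K with cornerH (P k₀) | cornerV (P k₀)
... | inj₂ b≡x | inj₁ c≡y = edge-clique-bending-up-from-left N k₀∈K b≡x c≡y
... | inj₁ a≡x | inj₁ c≡y =
  edge-clique-via reflectX N k₀∈K (cong -_ a≡x) c≡y
... | inj₂ b≡x | inj₂ d≡y =
  edge-clique-via reflectY N k₀∈K b≡x (cong -_ d≡y)
... | inj₁ a≡x | inj₂ d≡y =
  edge-clique-via (reflectY ∘ˢ reflectX) N k₀∈K (cong -_ a≡x) (cong -_ d≡y)

module RowClique {n} (K : Subset n) (P : Fin n → B1Path) {i₀ y₀ : ℤ}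
  (on-row : ∀ k → k ∈ K → hor i₀ y₀ ∈E P k) {k₀} (k₀∈K : k₀ ∈ K) where

  private
    max-a : ∃ λ m → m ∈ K × (∀ k → k ∈ K → a (P k) ℤ.≤ a (P m))
    max-a = argmax-subset K (λ k → a (P k)) k₀∈K

    min-b : ∃ λ m → m ∈ K × (∀ k → k ∈ K → b (P m) ℤ.≤ b (P k))
    min-b = argmin-subset K (λ k → b (P k)) k₀∈K

    kA kB : Fin n
    kA = proj₁ max-a
    kB = proj₁ min-b

    kA∈K : kA ∈ K
    kA∈K = proj₁ (proj₂ max-a)

    kB∈K : kB ∈ K
    kB∈K = proj₁ (proj₂ min-b)

    pA pB : B1Path
    pA = P kA
    pB = P kB

  A B : ℤ
  A = a pA
  B = b pB

  private
    a≤A : ∀ k → k ∈ K → a (P k) ℤ.≤ A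
    a≤A = proj₂ (proj₂ max-a)

    B≤b : ∀ k → k ∈ K → B ℤ.≤ b (P k)
    B≤b = proj₂ (proj₂ min-b)

    y₀≡y : ∀ k → k ∈ K → y₀ ≡ y (P k)
    y₀≡y k k∈K = proj₁ (on-row k k∈K)

    A<B : A ℤ.< B
    A<B = ≤-<-trans (proj₁ (proj₂ (on-row kA kA∈K))) (proj₂ (proj₂ (on-row kB kB∈K)))

    segment-edge : ∀ {w} i → A ℤ.≤ i → i ℤ.< B → hor i y₀ ∈E w → CommonEdgeWith K P w
    segment-edge i A≤i i<B h∈w =
      hor i y₀ , h∈w , λ k k∈K → y₀≡y k k∈K , ≤-trans (a≤A k k∈K) A≤i , <-≤-trans i<B (B≤b k k∈K)

  LeftClaw RightClaw : B1Path → Set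
  LeftClaw = TwoOf (hor (pred A) y₀) (ver A y₀) (ver A (pred y₀))
  RightClaw = TwoOf (hor B y₀) (ver B y₀) (ver B (pred y₀))

  Extension : B1Path → Set
  Extension w = CommonEdgeWith K P w ⊎ LeftClaw w ⊎ RightClaw w

  module _ {w : B1Path} (meets : ∀ k → k ∈ K → Share w (P k)) where

    private
      row-of : ∀ {k i j} → k ∈ K → hor i j ∈E w → hor i j ∈E P k → hor i y₀ ∈E w
      row-of {k} k∈K (j≡yw , a≤i , i<b) (j≡yk , _) = trans (trans (y₀≡y k k∈K) (sym j≡yk)) j≡yw , a≤i , i<b

      Left Right : Set
      Left = ∃ λ i → hor i y₀ ∈E w × i ℤ.< A
      Right = ∃ λ i → hor i y₀ ∈E w × B ℤ.≤ i

      Column : ℤ → Set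
      Column X = ∃ λ j → ver X j ∈E w

      via-pB : CommonEdgeWith K P w ⊎ Left ⊎ Column (x pB)
      via-pB with meets kB kB∈K
      ... | ver i j , v∈w , (i≡x , _) = inj₂ (inj₂ (j , subst (λ i → ver i j ∈E w) i≡x v∈w))
      ... | hor i j , h∈w , h∈pB with A ℤ.≤? i
      ...   | yes A≤i = inj₁ (segment-edge i A≤i (proj₂ (proj₂ h∈pB)) (row-of kB∈K h∈w h∈pB))
      ...   | no A≰i = inj₂ (inj₁ (i , row-of kB∈K h∈w h∈pB , ≰⇒> A≰i))

      via-pA : CommonEdgeWith K P w ⊎ Right ⊎ Column (x pA)
      via-pA with meets kA kA∈K
      ... | ver i j , v∈w , (i≡x , _) = inj₂ (inj₂ (j , subst (λ i → ver i j ∈E w) i≡x v∈w))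
      ... | hor i j , h∈w , h∈pA with B ℤ.≤? i
      ...   | yes B≤i = inj₂ (inj₁ (i , row-of kA∈K h∈w h∈pA , B≤i))
      ...   | no B≰i = inj₁ (segment-edge i (proj₁ (proj₂ h∈pA)) (≰⇒> B≰i) (row-of kA∈K h∈w h∈pA))

      at-A : hor A y₀ ∈E w ⊎ hor (pred A) y₀ ∈E w → ver A y₀ ∈E w ⊎ ver A (pred y₀) ∈E w → Extension w
      at-A (inj₁ h) _ = inj₁ (segment-edge A ≤-refl A<B h)
      at-A (inj₂ h) v = inj₂ (inj₁ (two-of-either h v))

      at-B : hor B y₀ ∈E w ⊎ hor (pred B) y₀ ∈E w → ver B y₀ ∈E w ⊎ ver B (pred y₀) ∈E w → Extension w
      at-B (inj₁ h) v = inj₂ (inj₂ (two-of-either h v))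
      at-B (inj₂ h) _ = inj₁ (segment-edge (pred B) (i<j⇒i≤pred[j] A<B) (pred<self B) h)

      column-meet : ∀ {X} → x w ≡ X → (∀ {i} → ¬ hor i y₀ ∈E w) → ∀ {k} → k ∈ K →
        ∃ λ j → ver X j ∈E P k × ver X j ∈E w
      column-meet xw≡X off k∈K with meets _ k∈K
      ... | hor i j , h∈w , h∈P = ⊥-elim (off (row-of k∈K h∈w h∈P))
      ... | ver i j , (i≡xw , vw) , (i≡xk , vk) =
        j , (trans (sym xw≡X) (trans (sym i≡xw) i≡xk) , vk) , (sym xw≡X , vw)

      -- If w avoids row y₀, every path of K meets w in its column, hence bends at (X , y₀)
      -- towards w's column segment; unless that segment straddles y₀, its edge nearest to y₀
      -- is then common to all of them.
      off-row : ∀ {X} → x w ≡ X → (∀ {i} → ¬ hor i y₀ ∈E w) →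
        CommonEdgeWith K P w ⊎ (ver X y₀ ∈E w × ver X (pred y₀) ∈E w)
      off-row {X} xw≡X off with y₀ ℤ.≤? c w | d w ℤ.≤? y₀
      ... | yes y₀≤c | _ = inj₁ (ver X (c w) , (sym xw≡X , ≤-refl , c<d) , up)
        where
        c<d : c w ℤ.< d w
        c<d = let (_ , _ , (_ , c≤j , j<d)) = column-meet xw≡X off k₀∈K in ≤-<-trans c≤j j<d
        up : ∀ k → k ∈ K → ver X (c w) ∈E P k
        up k k∈K with column-meet xw≡X off k∈K | cornerV (P k)
        ... | j , (X≡x , _ , j<dk) , (_ , c≤j , _) | inj₁ ck≡y =
          X≡x , ≤-trans (≤-reflexive (trans ck≡y (sym (y₀≡y k k∈K)))) y₀≤c , ≤-<-trans c≤j j<dk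
        ... | j , (_ , _ , j<dk) , (_ , c≤j , _) | inj₂ dk≡y =
          ⊥-elim (≤⇒≯ (≤-trans y₀≤c c≤j) (<-≤-trans j<dk (≤-reflexive (trans dk≡y (sym (y₀≡y k k∈K))))))
      ... | no y₀≰c | yes d≤y₀ = inj₁ (ver X (pred (d w)) , (sym xw≡X , c≤pred[d] , pred<self (d w)) , down)
        where
        c≤pred[d] : c w ℤ.≤ pred (d w)
        c≤pred[d] = let (_ , _ , (_ , c≤j , j<d)) = column-meet xw≡X off k₀∈K
                    in i<j⇒i≤pred[j] (≤-<-trans c≤j j<d)
        down : ∀ k → k ∈ K → ver X (pred (d w)) ∈E P k
        down k k∈K with column-meet xw≡X off k∈K | cornerV (P k)
        ... | j , (X≡x , ck≤j , _) , (_ , _ , j<d) | inj₂ dk≡y =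
          X≡x , ≤-trans ck≤j (i<j⇒i≤pred[j] j<d) ,
          <-≤-trans (pred<self (d w)) (≤-trans d≤y₀ (≤-reflexive (trans (y₀≡y k k∈K) (sym dk≡y))))
        ... | j , (_ , ck≤j , _) , (_ , _ , j<d) | inj₁ ck≡y =
          ⊥-elim (≤⇒≯ (≤-trans (≤-reflexive (trans (y₀≡y k k∈K) (sym ck≡y))) ck≤j) (<-≤-trans j<d d≤y₀))
      ... | no y₀≰c | no d≰y₀ =
        inj₂ ((sym xw≡X , <⇒≤ c<y₀ , ≰⇒> d≰y₀) ,
              (sym xw≡X , i<j⇒i≤pred[j] c<y₀ , <-≤-trans (pred<self y₀) (<⇒≤ (≰⇒> d≰y₀))))
        where
        c<y₀ : c w ℤ.< y₀
        c<y₀ = ≰⇒> y₀≰c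

      column : ∀ {X i j} → x w ≡ X → ver i j ∈E w →
        CommonEdgeWith K P w
        ⊎ ((hor X y₀ ∈E w ⊎ hor (pred X) y₀ ∈E w) × (ver X y₀ ∈E w ⊎ ver X (pred y₀) ∈E w))
        ⊎ (ver X y₀ ∈E w × ver X (pred y₀) ∈E w)
      column xw≡X v∈w with y w ℤ.≟ y₀ | a w ℤ.<? b w
      ... | yes yw≡y₀ | yes a<b =
        inj₂ (inj₁ (corner-hor w xw≡X yw≡y₀ (refl , ≤-refl , a<b) , corner-ver w xw≡X yw≡y₀ v∈w))
      ... | yes _ | no a≮b = Sum.map₂ inj₂ (off-row xw≡X (λ (_ , a≤i , i<b) → a≮b (≤-<-trans a≤i i<b)))
      ... | no yw≢y₀ | _ = Sum.map₂ inj₂ (off-row xw≡X (λ (y₀≡yw , _) → yw≢y₀ (sym y₀≡yw)))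

      column-at-A : ∀ {i j} → x w ≡ A → ver i j ∈E w → Extension w
      column-at-A xw≡A v∈w with column xw≡A v∈w
      ... | inj₁ common = inj₁ common
      ... | inj₂ (inj₁ (h , v)) = at-A h v
      ... | inj₂ (inj₂ (v , v⁻)) = inj₂ (inj₁ (has₂₃ v v⁻))

      column-at-B : ∀ {i j} → x w ≡ B → ver i j ∈E w → Extension w
      column-at-B xw≡B v∈w with column xw≡B v∈w
      ... | inj₁ common = inj₁ common
      ... | inj₂ (inj₁ (h , v)) = at-B h v
      ... | inj₂ (inj₂ (v , v⁻)) = inj₂ (inj₂ (has₂₃ v v⁻))

      left-and-right : Left → Right → CommonEdgeWith K P w
      left-and-right (i , h , i<A) (i' , h' , B≤i') =
        segment-edge A ≤-refl A<B (hor-convex {y₀} {w} (<⇒≤ i<A) (≤-trans (<⇒≤ A<B) B≤i') h h')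

      left-and-column : Left → Column (x pA) → Extension w
      left-and-column (i , h∈w@(y₀≡yw , a≤i , _) , i<A) (j , v∈w@(xA≡xw , _)) with x w ℤ.≤? A
      ... | yes xw≤A = at-A (corner-hor w xw≡A (sym y₀≡yw) h∈w) (corner-ver w xw≡A (sym y₀≡yw) v∈w)
        where
        xw≡A : x w ≡ A
        xw≡A = ≤-antisym xw≤A (subst (A ℤ.≤_) xA≡xw (a≤x pA))
      ... | no xw≰A =
        inj₁ (segment-edge A ≤-refl A<B (y₀≡yw , ≤-trans a≤i (<⇒≤ i<A) , <-≤-trans (≰⇒> xw≰A) (x≤b w)))

      column-and-right : Column (x pB) → Right → Extension w
      column-and-right (j , v∈w@(xB≡xw , _)) (i , h∈w@(y₀≡yw , _ , i<b) , B≤i) with B ℤ.≤? x w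
      ... | yes B≤xw = at-B (corner-hor w xw≡B (sym y₀≡yw) h∈w) (corner-ver w xw≡B (sym y₀≡yw) v∈w)
        where
        xw≡B : x w ≡ B
        xw≡B = ≤-antisym (subst (ℤ._≤ B) xB≡xw (x≤b pB)) B≤xw
      ... | no B≰xw =
        inj₁ (segment-edge (pred B) (i<j⇒i≤pred[j] A<B) (pred<self B)
               (y₀≡yw , ≤-trans (a≤x w) (i<j⇒i≤pred[j] (≰⇒> B≰xw)) ,
                <-≤-trans (pred<self B) (<⇒≤ (≤-<-trans B≤i i<b))))

      -- The column of pB lies at a pB ≤ A or at B, and the column of pA at or right of A.
      column-and-column : Column (x pB) → Column (x pA) → Extension w
      column-and-column (_ , v∈w@(xB≡xw , _)) (_ , (xA≡xw , _)) with cornerH pB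
      ... | inj₂ b≡x = column-at-B (trans (sym xB≡xw) (sym b≡x)) v∈w
      ... | inj₁ a≡x = column-at-A (≤-antisym xw≤A (subst (A ℤ.≤_) xA≡xw (a≤x pA))) v∈w
        where
        xw≤A : x w ℤ.≤ A
        xw≤A = subst (ℤ._≤ A) (trans a≡x xB≡xw) (a≤A kB kB∈K)

    extension : Extension w
    extension with via-pB | via-pA
    ... | inj₁ common | _ = inj₁ common
    ... | inj₂ _ | inj₁ common = inj₁ common
    ... | inj₂ (inj₁ left) | inj₂ (inj₁ right) = inj₁ (left-and-right left right)
    ... | inj₂ (inj₁ left) | inj₂ (inj₂ colA) = left-and-column left colA
    ... | inj₂ (inj₂ colB) | inj₂ (inj₁ right) = column-and-right colB right
    ... | inj₂ (inj₂ colB) | inj₂ (inj₂ colA) = column-and-column colB colA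

  one-extends : ∀ {w₁ w₂ w₃} →
    (∀ k → k ∈ K → Share w₁ (P k)) → (∀ k → k ∈ K → Share w₂ (P k)) → (∀ k → k ∈ K → Share w₃ (P k)) →
    ¬ Share w₁ w₂ → ¬ Share w₁ w₃ → ¬ Share w₂ w₃ →
    CommonEdgeWith K P w₁ ⊎ CommonEdgeWith K P w₂ ⊎ CommonEdgeWith K P w₃
  one-extends m₁ m₂ m₃ n₁₂ n₁₃ n₂₃ with extension m₁ | extension m₂ | extension m₃
  ... | inj₁ c₁ | _ | _ = inj₁ c₁
  ... | inj₂ _ | inj₁ c₂ | _ = inj₂ (inj₁ c₂)
  ... | inj₂ _ | inj₂ _ | inj₁ c₃ = inj₂ (inj₂ c₃)
  ... | inj₂ (inj₁ l₁) | inj₂ (inj₁ l₂) | inj₂ _ = ⊥-elim (n₁₂ (two-of-share l₁ l₂))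
  ... | inj₂ (inj₁ l₁) | inj₂ (inj₂ _) | inj₂ (inj₁ l₃) = ⊥-elim (n₁₃ (two-of-share l₁ l₃))
  ... | inj₂ (inj₂ _) | inj₂ (inj₁ l₂) | inj₂ (inj₁ l₃) = ⊥-elim (n₂₃ (two-of-share l₂ l₃))
  ... | inj₂ (inj₂ r₁) | inj₂ (inj₂ r₂) | inj₂ _ = ⊥-elim (n₁₂ (two-of-share r₁ r₂))
  ... | inj₂ (inj₂ r₁) | inj₂ (inj₁ _) | inj₂ (inj₂ r₃) = ⊥-elim (n₁₃ (two-of-share r₁ r₃))
  ... | inj₂ (inj₁ _) | inj₂ (inj₂ r₂) | inj₂ (inj₂ r₃) = ⊥-elim (n₂₃ (two-of-share r₂ r₃))

one-extends-edge-clique : ∀ {n} {K : Subset n} {P w₁ w₂ w₃} → CommonEdge K P → ∀ {k₀} → k₀ ∈ K →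
  (∀ k → k ∈ K → Share w₁ (P k)) → (∀ k → k ∈ K → Share w₂ (P k)) → (∀ k → k ∈ K → Share w₃ (P k)) →
  ¬ Share w₁ w₂ → ¬ Share w₁ w₃ → ¬ Share w₂ w₃ →
  CommonEdgeWith K P w₁ ⊎ CommonEdgeWith K P w₂ ⊎ CommonEdgeWith K P w₃
one-extends-edge-clique {K = K} {P} (hor _ _ , on-row) k₀∈K = RowClique.one-extends K P on-row k₀∈K
one-extends-edge-clique {K = K} {P} (ver i j , on-column) k₀∈K m₁ m₂ m₃ n₁₂ n₁₃ n₂₃ =
  Sum.map common-edge-with⁻¹ (Sum.map common-edge-with⁻¹ common-edge-with⁻¹)
    (RowClique.one-extends K (λ v → path (P v)) (λ k k∈K → ∈-path {ver i j} {P k} (on-column k k∈K)) k₀∈K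
      (λ k k∈K → share (m₁ k k∈K)) (λ k k∈K → share (m₂ k k∈K)) (λ k k∈K → share (m₃ k k∈K))
      (λ s → n₁₂ (share⁻¹ s)) (λ s → n₁₃ (share⁻¹ s)) (λ s → n₂₃ (share⁻¹ s)))
  where open Symmetry transpose

nonempty-of-size : ∀ {n} (K : Subset n) → 1 ≤ ∣ K ∣ → Nonempty K
nonempty-of-size {n} K 1≤∣K∣ with nonempty? K
... | yes nonempty = nonempty
... | no empty = ⊥-elim (1≰0 (subst (1 ≤_) (∣⊥∣≡0 n) (subst (λ p → 1 ≤ ∣ p ∣) (Empty-unique empty) 1≤∣K∣)))
  where
  1≰0 : ¬ 1 ≤ 0
  1≰0 ()

lemma5 : ∀ (n : ℕ) (G : Graph n) (K : Subset n) (w₁ w₂ w₃ : Fin n) →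
    2 ≤ ∣ K ∣ →
    IsClique G K →
    w₁ ∉ K → w₂ ∉ K → w₃ ∉ K →
    w₁ ≢ w₂ → w₁ ≢ w₃ → w₂ ≢ w₃ →
    ¬ Graph.Adj G w₁ w₂ → ¬ Graph.Adj G w₁ w₃ → ¬ Graph.Adj G w₂ w₃ →
    (∀ v → v ∈ K ⊎ (v ≡ w₁ ⊎ (v ≡ w₂ ⊎ v ≡ w₃))) →
    (∀ u → u ∈ K → Graph.Adj G u w₁ × Graph.Adj G u w₂ × Graph.Adj G u w₃) →
    (P : Fin n → B1Path) → IsB1EPG G P →
    IsEdgeClique P (λ v → v ∈ K ⊎ v ≡ w₁)
      ⊎ (IsEdgeClique P (λ v → v ∈ K ⊎ v ≡ w₂)
      ⊎ IsEdgeClique P (λ v → v ∈ K ⊎ v ≡ w₃))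
-- Only K ∪ {wᵢ} matters.
lemma5 n G K w₁ w₂ w₃ 2≤∣K∣ K-clique w₁∉K w₂∉K w₃∉K w₁≢w₂ w₁≢w₃ w₂≢w₃ ¬w₁w₂ ¬w₁w₃ ¬w₂w₃ _ K-w P rep
  with nonempty-of-size K (ℕ.<⇒≤ 2≤∣K∣)
... | _ , k₀∈K =
  Sum.map joins (Sum.map joins joins)
    (one-extends-edge-clique (edge-clique neighbours k₀∈K) k₀∈K meets₁ meets₂ meets₃
      (apart w₁≢w₂ ¬w₁w₂) (apart w₁≢w₃ ¬w₁w₃) (apart w₂≢w₃ ¬w₂w₃))
  where
  open Graph G using (Adj) renaming (sym to adj-sym)

  share : ∀ {u v} → u ≢ v → Adj u v → Share (P u) (P v)
  share {u} {v} u≢v = Equivalence.to (rep u v u≢v)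

  apart : ∀ {u v} → u ≢ v → ¬ Adj u v → ¬ Share (P u) (P v)
  apart {u} {v} u≢v ¬adj s = ¬adj (Equivalence.from (rep u v u≢v) s)

  meets : ∀ {w} → w ∉ K → (∀ k → k ∈ K → Adj k w) → ∀ k → k ∈ K → Share (P w) (P k)
  meets w∉K adj k k∈K = share (λ w≡k → w∉K (subst (_∈ K) (sym w≡k) k∈K)) (adj-sym (adj k k∈K))

  meets₁ : ∀ k → k ∈ K → Share (P w₁) (P k)
  meets₁ = meets w₁∉K (λ k k∈K → proj₁ (K-w k k∈K))

  meets₂ : ∀ k → k ∈ K → Share (P w₂) (P k)
  meets₂ = meets w₂∉K (λ k k∈K → proj₁ (proj₂ (K-w k k∈K)))

  meets₃ : ∀ k → k ∈ K → Share (P w₃) (P k)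
  meets₃ = meets w₃∉K (λ k k∈K → proj₂ (proj₂ (K-w k k∈K)))

  neighbours : ApartNeighbours K P (P w₁) (P w₂)
  neighbours = record
    { clique = λ u v u∈K v∈K u≢v → share u≢v (K-clique u v u∈K v∈K u≢v)
    ; meets₁ = meets₁
    ; meets₂ = meets₂
    ; apart = apart w₁≢w₂ ¬w₁w₂
    }

  joins : ∀ {w} → CommonEdgeWith K P (P w) → IsEdgeClique P (λ v → v ∈ K ⊎ v ≡ w)
  joins (e , e∈w , e∈K) = e , λ { v (inj₁ v∈K) → e∈K v v∈K ; _ (inj₂ refl) → e∈w }
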